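{- Let $r\ge2$ and $a,b,p\ge1$ be integers, let $m\ge a+b$, and let $F=\left[\begin{smallmatrix}\mathbf{0}_{a\times p}\\ \mathbf{1}_{b\times p}\end{smallmatrix}\right]$. If $(r-2)^{m-a-b}\ge p-1$, then \[\operatorname{forb}(m,r,F)=\sum_{\ell=0}^{a-1}\binom{m}{\ell}(r-1)^{m-\ell}+\sum_{k=0}^{b-1}\binom{m}{k}(r-1)^{m-k}-\sum_{\ell=0}^{a-1}\sum_{k=0}^{b-1}\binom{m}{\ell}\binom{m-\ell}{k}(r-2)^{m-\ell-k}+(p-1)\binom{m}{a}\binom{m-a}{b}.\]
   Context: An $r$-matrix is a matrix with entries in $\{0,1,\dots,r-1\}$. A matrix is simple if it has no repeated columns. For matrices $F$ and $A$, $A$ avoids $F$ if no submatrix of $A$ is a row and column permutation of $F$. $\operatorname{forb}(m,r,F)$ is the maximum number of columns of a simple $m$-rowed $r$-matrix that avoids $F$. $\mathbf{0}_{a\times p}$ and $\mathbf{1}_{b\times p}$ are the all-zero $a\times p$ and all-one $b\times p$ matrices; $F$ is the $(a+b)\times p$ matrix with the former stacked on top of the latter. Convention: $0^0=1$. -}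

module Defs where

open import Data.Nat using (ℕ; zero; suc; _+_; _*_; _∸_; _^_; _≤_; _<?_)
open import Data.Nat.Combinatorics using (_C_)
open import Data.Integer as ℤ using (ℤ; +_)
open import Data.Fin using (Fin; toℕ)
open import Data.Product using (Σ; ∃; _×_)
open import Relation.Nullary using (¬_; does)
open import Relation.Binary.PropositionalEquality using (_≡_; _≢_)
open import Function.Definitions using (Injective)
open import Data.Bool using (if_then_else_)

Matrix : ℕ → ℕ → ℕ → Set
Matrix m n r = Fin m → Fin n → Fin r

Simple : ∀ {m n r} → Matrix m n r → Set
Simple {m} {n} A = (j j' : Fin n) → j ≢ j' → Σ (Fin m) λ i → A i j ≢ A i j'

-- A contains F (a k × l matrix with natural-number entries) if some submatrix of A
-- is a row and column permutation of F, i.e. there are injective row and column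
-- selections σ, τ with A (σ i) (τ j) = F i j for all i, j.
Contains : ∀ {m n r k l} → Matrix m n r → (Fin k → Fin l → ℕ) → Set
Contains {m} {n} {r} {k} {l} A F =
  Σ (Fin k → Fin m) λ σ → Σ (Fin l → Fin n) λ τ →
    Injective _≡_ _≡_ σ × Injective _≡_ _≡_ τ ×
    ((i : Fin k) (j : Fin l) → toℕ (A (σ i) (τ j)) ≡ F i j)

Avoids : ∀ {m n r k l} → Matrix m n r → (Fin k → Fin l → ℕ) → Set
Avoids A F = ¬ Contains A F

ForbIs : ∀ {k l} → ℕ → ℕ → (Fin k → Fin l → ℕ) → ℤ → Set
ForbIs m r F N =
  (Σ ℕ λ n → Σ (Matrix m n r) λ A → Simple A × Avoids A F × (+ n ≡ N)) ×
  ((n : ℕ) (A : Matrix m n r) → Simple A → Avoids A F → + n ℤ.≤ N)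

F : (a b p : ℕ) → Fin (a + b) → Fin p → ℕ
F a b p i j = if does (toℕ i <? a) then 0 else 1

sumTo : ℕ → (ℕ → ℤ) → ℤ
sumTo zero f = + 0
sumTo (suc n) f = sumTo n f ℤ.+ f n

rhs : (m r a b p : ℕ) → ℤ
rhs m r a b p =
  sumTo a (λ ℓ → + ((m C ℓ) * (r ∸ 1) ^ (m ∸ ℓ)))
  ℤ.+ sumTo b (λ k → + ((m C k) * (r ∸ 1) ^ (m ∸ k)))
  ℤ.- sumTo a (λ ℓ → sumTo b (λ k → + ((m C ℓ) * ((m ∸ ℓ) C k) * (r ∸ 2) ^ (m ∸ ℓ ∸ k))))
  ℤ.+ + ((p ∸ 1) * (m C a) * ((m ∸ a) C b))

module Submission where

-- Proposition 5.1.  Write r = 2 + t and p = 1 + p′ and read columns as words of length m over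
-- Fin r.  A word is light if it has fewer than a zeros or fewer than b ones, heavy otherwise; a
-- shape is a word over {0,1,2} with exactly a zeros and b ones.  forb equals
-- (#light words) + p′·(#shapes):
--  * upper bound: a light column is charged to itself, a heavy one to its trace (first a zeros,
--    first b ones, all else 2), which is a shape; simplicity gives one column per light word, and
--    p columns charged to one shape would form a copy of F, so double counting bounds n;
--  * construction: all light words plus p′ words of each shape (a shape has t^(m-a-b) ≥ p′
--    words); the columns of a copy of F are heavy, their zeros and ones are exactly the rows of
--    the copy, so they share one shape, which has only p′ columns;
--  * counting: inclusion–exclusion, with C(m,ℓ)(t+1)^(m-ℓ) words having ℓ copies of a letter and
--    C(m,ℓ)C(m-ℓ,k)t^(m-ℓ-k) words having ℓ zeros and k ones, both by Pascal's rule.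

open import Defs
open import Data.Nat using (ℕ; zero; suc; _+_; _*_; _∸_; _^_; _≤_; _<_; _⊓_; s≤s; z≤n; _≡ᵇ_; _<ᵇ_; _<?_)
import Data.Nat.Properties
open Data.Nat.Properties
  using ( _≤?_; ≤-trans; ≤-reflexive; <-irrefl; ≰⇒>; ≮⇒≥; <⇒≱; <ᵇ⇒<; <⇒<ᵇ; ≡ᵇ⇒≡; ≡⇒≡ᵇ
        ; m≤n+m; m≤m+n
        ; +-mono-≤; +-assoc; +-identityʳ; +-suc; *-identityˡ; *-identityʳ; *-zeroʳ; *-comm; *-assoc
        ; *-distribʳ-+; +-∸-assoc; m+n∸m≡n; m≤n⇒m⊓n≡m; m⊓n≤m; ^-zeroˡ)
open import Data.Nat.Combinatorics using (_C_; k>n⇒nCk≡0; nCk+nC[k+1]≡[n+1]C[k+1])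
open import Data.Nat.Tactic.RingSolver using (solve-∀)
open import Data.Integer as ℤ using (ℤ; +_)
import Data.Integer.Properties as ℤ
import Data.Integer.Tactic.RingSolver as ℤ-Solver
open import Data.Bool using (Bool; true; false; if_then_else_; _∧_; _∨_; T; T?)
open import Data.Bool.Properties using (∧-zeroʳ; T-∧)
open import Data.List as List using (List; []; _∷_; _++_; map; length; concatMap; filter; filterᵇ; allFin; take)
open import Data.List.Properties using (length-tabulate; length-++; length-take)
open import Data.List.Membership.Propositional using (_∈_; lose; find)
open import Data.List.Membership.Propositional.Properties
  using ( ∈-map⁺; ∈-map⁻; ∈-++⁺ˡ; ∈-++⁺ʳ; ∈-++⁻; ∈-filter⁺; ∈-filter⁻; ∈-allFin; ∈-lookup
        ; ∈-concatMap⁺; ∈-concatMap⁻)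
open import Data.List.Relation.Unary.Any using (here; there; index)
open import Data.List.Relation.Unary.Any.Properties using (lookup-index)
import Data.List.Relation.Unary.All as All
open import Data.List.Relation.Unary.AllPairs using ([]; _∷_)
open import Data.List.Relation.Unary.Unique.Propositional using (Unique)
open import Data.List.Relation.Unary.Unique.Propositional.Properties
  using (++⁺; map⁺; filter⁺; take⁺; allFin⁺; Unique[x∷xs]⇒x∉xs)
import Data.List.Relation.Binary.Sublist.Propositional as Sublist
open import Data.List.Relation.Binary.Sublist.Propositional.Properties using (take-⊆)
open import Data.Fin as Fin using (Fin; toℕ; inject≤; _↑ˡ_; _↑ʳ_; splitAt)
open import Data.Fin.Properties
  using ( injective⇒≤; inject≤-injective; any?; ¬∀⟶∃¬; toℕ-injective; toℕ<n; toℕ-↑ˡ; toℕ-↑ʳ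
        ; ↑ˡ-injective; ↑ʳ-injective; splitAt⁻¹-↑ˡ; splitAt⁻¹-↑ʳ)
  renaming (_≟_ to _≟ᶠ_)
open import Data.Vec as Vec using (Vec; []; _∷_; count; lookup; tabulate)
open import Data.Vec.Properties using (lookup∘tabulate; tabulate∘lookup; tabulate-cong; lookup-map)
import Data.Vec.Properties
open import Data.Sum using (_⊎_; inj₁; inj₂; [_,_]′)
import Data.Sum.Properties
open import Data.Product using (Σ; ∃; _×_; _,_; proj₁; proj₂)
open import Data.Empty using (⊥; ⊥-elim)
open import Relation.Nullary using (does; yes; no)
open import Relation.Nullary.Decidable using (dec-true; dec-false)
open import Relation.Unary using (Decidable)
open import Relation.Binary.Definitions using (DecidableEquality)
open import Relation.Binary.PropositionalEquality
open import Function using (_∘_; id)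
open import Function.Definitions using (Injective)
open import Function.Bundles using (Equivalence)

private variable
  A B : Set
  k m n r s t : ℕ

𝟙 : Bool → ℕ
𝟙 true = 1
𝟙 false = 0

∑ : List A → (A → ℕ) → ℕ
∑ [] f = 0
∑ (x ∷ xs) f = f x + ∑ xs f

∑-cong : (xs : List A) {f g : A → ℕ} → (∀ x → x ∈ xs → f x ≡ g x) → ∑ xs f ≡ ∑ xs g
∑-cong [] eq = refl
∑-cong (x ∷ xs) eq = cong₂ _+_ (eq x (here refl)) (∑-cong xs (λ y y∈ → eq y (there y∈)))

∑-mono : (xs : List A) {f g : A → ℕ} → (∀ x → x ∈ xs → f x ≤ g x) → ∑ xs f ≤ ∑ xs g
∑-mono [] le = z≤n
∑-mono (x ∷ xs) le = +-mono-≤ (le x (here refl)) (∑-mono xs (λ y y∈ → le y (there y∈)))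

∑-const : (xs : List A) (c : ℕ) → ∑ xs (λ _ → c) ≡ length xs * c
∑-const [] c = refl
∑-const (x ∷ xs) c = cong (_+_ c) (∑-const xs c)

∑-zero : (xs : List A) → ∑ xs (λ _ → 0) ≡ 0
∑-zero xs = trans (∑-const xs 0) (*-zeroʳ (length xs))

length-as-∑ : (xs : List A) → length xs ≡ ∑ xs (λ _ → 1)
length-as-∑ xs = sym (trans (∑-const xs 1) (*-identityʳ (length xs)))

∑-++ : (xs ys : List A) (f : A → ℕ) → ∑ (xs ++ ys) f ≡ ∑ xs f + ∑ ys f
∑-++ [] ys f = refl
∑-++ (x ∷ xs) ys f = trans (cong (_+_ (f x)) (∑-++ xs ys f)) (sym (+-assoc (f x) _ _))

∑-map : (g : A → B) (xs : List A) (f : B → ℕ) → ∑ (map g xs) f ≡ ∑ xs (f ∘ g)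
∑-map g [] f = refl
∑-map g (x ∷ xs) f = cong (_+_ (f (g x))) (∑-map g xs f)

∑-concatMap : (g : A → List B) (xs : List A) (f : B → ℕ) → ∑ (concatMap g xs) f ≡ ∑ xs (λ x → ∑ (g x) f)
∑-concatMap g [] f = refl
∑-concatMap g (x ∷ xs) f = trans (∑-++ (g x) _ f) (cong (_+_ (∑ (g x) f)) (∑-concatMap g xs f))

∑-+ : (xs : List A) (f g : A → ℕ) → ∑ xs (λ x → f x + g x) ≡ ∑ xs f + ∑ xs g
∑-+ [] f g = refl
∑-+ (x ∷ xs) f g = trans (cong (_+_ (f x + g x)) (∑-+ xs f g)) (interchange (f x) (g x) _ _)
  where
  interchange : ∀ a b c d → a + b + (c + d) ≡ a + c + (b + d)
  interchange = solve-∀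

∑-swap : (xs : List A) (ys : List B) (f : A → B → ℕ) →
  ∑ xs (λ x → ∑ ys (f x)) ≡ ∑ ys (λ y → ∑ xs (λ x → f x y))
∑-swap [] ys f = sym (∑-zero ys)
∑-swap (x ∷ xs) ys f = trans (cong (_+_ (∑ ys (f x))) (∑-swap xs ys f)) (sym (∑-+ ys (f x) _))

∑-tabulate : (g : Fin n → A) (f : A → ℕ) → ∑ (List.tabulate g) f ≡ ∑ (allFin n) (f ∘ g)
∑-tabulate {zero} g f = refl
∑-tabulate {suc n} g f =
  cong (_+_ (f (g Fin.zero))) (trans (∑-tabulate (g ∘ Fin.suc) f) (sym (∑-tabulate Fin.suc (f ∘ g))))

∑-allFin-suc : (f : Fin (suc n) → ℕ) → ∑ (allFin (suc n)) f ≡ f Fin.zero + ∑ (allFin n) (f ∘ Fin.suc)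
∑-allFin-suc f = cong (_+_ (f Fin.zero)) (∑-tabulate Fin.suc f)

∑-allFin-const : (n c : ℕ) → ∑ (allFin n) (λ _ → c) ≡ n * c
∑-allFin-const n c = trans (∑-const (allFin n) c) (cong (_* c) (length-tabulate {n = n} (λ i → i)))

length-filter : {P : A → Set} (P? : Decidable P) (xs : List A) →
  length (filter P? xs) ≡ ∑ xs (λ x → 𝟙 (does (P? x)))
length-filter P? [] = refl
length-filter P? (x ∷ xs) with does (P? x)
... | true = cong suc (length-filter P? xs)
... | false = length-filter P? xs


injection-length : (L : List A) (g : Fin k → A) → Injective _≡_ _≡_ g → (∀ i → g i ∈ L) → k ≤ length L
injection-length L g g-inj g∈L = injective⇒≤ {f = λ i → index (g∈L i)} λ {i} {j} same-index →
  g-inj (trans (lookup-index (g∈L i)) (trans (cong (List.lookup L) same-index) (sym (lookup-index (g∈L j)))))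

lookup-injective : {L : List A} → Unique L → Injective _≡_ _≡_ (List.lookup L)
lookup-injective {L = x ∷ xs} (x∉ ∷ u) {Fin.zero} {Fin.zero} eq = refl
lookup-injective {L = x ∷ xs} (x∉ ∷ u) {Fin.zero} {Fin.suc j} eq = ⊥-elim (All.lookup x∉ (∈-lookup j) eq)
lookup-injective {L = x ∷ xs} (x∉ ∷ u) {Fin.suc i} {Fin.zero} eq = ⊥-elim (All.lookup x∉ (∈-lookup i) (sym eq))
lookup-injective {L = x ∷ xs} (x∉ ∷ u) {Fin.suc i} {Fin.suc j} eq = cong Fin.suc (lookup-injective u eq)

choose-distinct : {J : List A} → Unique J → k ≤ length J →
  Σ (Fin k → A) λ g → Injective _≡_ _≡_ g × (∀ i → g i ∈ J)
choose-distinct {J = J} u k≤ =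
  (λ i → List.lookup J (inject≤ i k≤)) ,
  (λ eq → inject≤-injective k≤ k≤ _ _ (lookup-injective u eq)) ,
  (λ i → ∈-lookup (inject≤ i k≤))

concatMap-unique : (f : B → List A) (key : A → B) → (∀ q {v} → v ∈ f q → key v ≡ q) →
  (∀ q → Unique (f q)) → {qs : List B} → Unique qs → Unique (concatMap f qs)
concatMap-unique f key key-f f-unique {[]} u = []
concatMap-unique f key key-f f-unique {q ∷ qs} u@(_ ∷ u-qs) =
  ++⁺ (f-unique q) (concatMap-unique f key key-f f-unique u-qs) λ (v∈fq , v∈rest) →
    let (q′ , q′∈qs , v∈fq′) = find (∈-concatMap⁻ f v∈rest)
    in Unique[x∷xs]⇒x∉xs u (subst (_∈ qs) (trans (sym (key-f q′ v∈fq′)) (key-f q v∈fq)) q′∈qs)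


occurs-in : (_≟_ : DecidableEquality B) {y : B} {L : List B} → y ∈ L →
  1 ≤ ∑ L (λ y′ → 𝟙 (does (y ≟ y′)))
occurs-in _≟_ {y} (here refl) rewrite dec-true (y ≟ y) refl = s≤s z≤n
occurs-in _≟_ (there y∈L) = ≤-trans (occurs-in _≟_ y∈L) (m≤n+m _ _)

fibre-sum : (_≟_ : DecidableEquality B) (key : A → B) (L : List B) (J : List A) →
  (∀ x → x ∈ J → key x ∈ L) → length J ≤ ∑ L (λ y → length (filter (λ x → key x ≟ y) J))
fibre-sum _≟_ key L J key∈L = begin
  length J                                        ≡⟨ length-as-∑ J ⟩
  ∑ J (λ _ → 1)                                   ≤⟨ ∑-mono J (λ x x∈J → occurs-in _≟_ (key∈L x x∈J)) ⟩
  ∑ J (λ x → ∑ L (λ y → 𝟙 (does (key x ≟ y))))   ≡⟨ ∑-swap J L _ ⟩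
  ∑ L (λ y → ∑ J (λ x → 𝟙 (does (key x ≟ y))))
    ≡⟨ ∑-cong L (λ y _ → sym (length-filter (λ x → key x ≟ y) J)) ⟩
  ∑ L (λ y → length (filter (λ x → key x ≟ y) J)) ∎
  where open Data.Nat.Properties.≤-Reasoning

fibre-bound : {B : Set} {n : ℕ} (_≟_ : DecidableEquality B) (key : Fin n → B) (L : List B) (bound : B → ℕ) →
  (∀ j → key j ∈ L) →
  (∀ y (τ : Fin (suc (bound y)) → Fin n) → Injective _≡_ _≡_ τ → (∀ i → key (τ i) ≡ y) → ⊥) →
  n ≤ ∑ L bound
fibre-bound {B} {n} _≟_ key L bound key∈L no-large-fibre = begin
  n                   ≡⟨ sym (length-tabulate {n = n} (λ j → j)) ⟩
  length (allFin n)   ≤⟨ fibre-sum _≟_ key L (allFin n) (λ j _ → key∈L j) ⟩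
  ∑ L (length ∘ fibre) ≤⟨ ∑-mono L (λ y _ → fibre-small y) ⟩
  ∑ L bound           ∎
  where
  open Data.Nat.Properties.≤-Reasoning
  fibre : B → List (Fin n)
  fibre y = filter (λ j → key j ≟ y) (allFin n)
  fibre-small : ∀ y → length (fibre y) ≤ bound y
  fibre-small y with length (fibre y) ≤? bound y
  ... | yes small = small
  ... | no large =
    let (τ , τ-injective , τ∈fibre) = choose-distinct (filter⁺ (λ j → key j ≟ y) (allFin⁺ n)) (≰⇒> large)
    in ⊥-elim (no-large-fibre y τ τ-injective (λ i → proj₂ (∈-filter⁻ (λ j → key j ≟ y) {xs = allFin n} (τ∈fibre i))))


words : (n m : ℕ) → List (Vec (Fin n) m)
words n zero = [] ∷ []
words n (suc m) = concatMap (λ x → map (x ∷_) (words n m)) (allFin n)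

∈-words : (v : Vec (Fin n) m) → v ∈ words n m
∈-words [] = here refl
∈-words (x ∷ v) = ∈-concatMap⁺ _ (lose (∈-allFin x) (∈-map⁺ (x ∷_) (∈-words v)))

words-unique : (n m : ℕ) → Unique (words n m)
words-unique n zero = All.[] ∷ []
words-unique n (suc m) =
  concatMap-unique (λ x → map (x ∷_) (words n m)) Vec.head
    (λ x v∈ → let (w , _ , v≡x∷w) = ∈-map⁻ (x ∷_) v∈ in cong Vec.head v≡x∷w)
    (λ x → map⁺ (cong Vec.tail) (words-unique n m)) (allFin⁺ n)

word-ext : {v w : Vec (Fin r) m} → (∀ i → lookup v i ≡ lookup w i) → v ≡ w
word-ext {v = v} {w} same = trans (sym (tabulate∘lookup v)) (trans (tabulate-cong same) (tabulate∘lookup w))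

∑-words-suc : (n m : ℕ) (f : Vec (Fin n) (suc m) → ℕ) →
  ∑ (words n (suc m)) f ≡ ∑ (allFin n) (λ x → ∑ (words n m) (λ v → f (x ∷ v)))
∑-words-suc n m f =
  trans (∑-concatMap (λ x → map (x ∷_) (words n m)) (allFin n) f)
        (∑-cong (allFin n) (λ x _ → ∑-map (x ∷_) (words n m) f))

∑-words-first : (t m : ℕ) (f : Vec (Fin (suc (suc t))) (suc m) → ℕ) →
  ∑ (words (suc (suc t)) (suc m)) f ≡
  ∑ (words (suc (suc t)) m) (λ v → f (Fin.zero ∷ v)) +
  (∑ (words (suc (suc t)) m) (λ v → f (Fin.suc Fin.zero ∷ v)) +
   ∑ (allFin t) (λ y → ∑ (words (suc (suc t)) m) (λ v → f (Fin.suc (Fin.suc y) ∷ v))))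
∑-words-first t m f =
  trans (∑-words-suc (suc (suc t)) m f)
   (trans (∑-allFin-suc {n = suc t} (λ x → ∑ W (λ v → f (x ∷ v))))
     (cong (_+_ (∑ W (λ v → f (Fin.zero ∷ v)))) (∑-allFin-suc {n = t} (λ x → ∑ W (λ v → f (Fin.suc x ∷ v))))))
  where
  W : List (Vec (Fin (suc (suc t))) m)
  W = words (suc (suc t)) m


occ : Fin n → Vec (Fin n) m → ℕ
occ x = count (_≟ᶠ x)

one : {n : ℕ} → Fin (suc (suc n))
one = Fin.suc Fin.zero

two : Fin 3
two = Fin.suc (Fin.suc Fin.zero)

module _ {P : A → Set} (P? : Decidable P) where

  positions : Vec A m → List (Fin m)
  positions {m} v = filter (λ i → P? (lookup v i)) (allFin m)

  count-as-sum : (v : Vec A m) → count P? v ≡ ∑ (allFin m) (λ i → 𝟙 (does (P? (lookup v i))))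
  count-as-sum [] = refl
  count-as-sum {suc m} (x ∷ v) with does (P? x)
  ... | true = cong suc (trans (count-as-sum v) (sym (∑-tabulate Fin.suc (λ i → 𝟙 (does (P? (lookup (x ∷ v) i)))))))
  ... | false = trans (count-as-sum v) (sym (∑-tabulate Fin.suc (λ i → 𝟙 (does (P? (lookup (x ∷ v) i))))))

  length-positions : (v : Vec A m) → length (positions v) ≡ count P? v
  length-positions v = trans (length-filter (λ i → P? (lookup v i)) (allFin _)) (sym (count-as-sum v))

  count-≥ : (v : Vec A m) (g : Fin k → Fin m) → Injective _≡_ _≡_ g → (∀ i → P (lookup v (g i))) →
    k ≤ count P? v
  count-≥ {k = k} v g g-injective g-P =
    subst (k ≤_) (length-positions v)
      (injection-length (positions v) g g-injective (λ i → ∈-filter⁺ (λ i → P? (lookup v i)) (∈-allFin (g i)) (g-P i)))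

  enumerate : (v : Vec A m) → count P? v ≡ k →
    Σ (Fin k → Fin m) λ g → Injective _≡_ _≡_ g × (∀ i → P (lookup v (g i)))
  enumerate {m} v count≡k =
    let (g , g-injective , g∈) = choose-distinct (filter⁺ (λ i → P? (lookup v i)) (allFin⁺ m))
                                   (≤-reflexive (sym (trans (length-positions v) count≡k)))
    in g , g-injective , λ i → proj₂ (∈-filter⁻ (λ i → P? (lookup v i)) {xs = allFin m} (g∈ i))

  exhaust : (v : Vec A m) (g : Fin k → Fin m) → Injective _≡_ _≡_ g → (∀ i → P (lookup v (g i))) →
    count P? v ≡ k → ∀ x → P (lookup v x) → ∃ λ i → g i ≡ x
  exhaust {k = k} v g g-injective g-P count≡k x x-P with any? (λ i → g i ≟ᶠ x)
  ... | yes hit = hit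
  ... | no miss = ⊥-elim (<-irrefl refl (subst (suc k ≤_) count≡k (count-≥ v g′ g′-injective g′-P)))
    where
    g′ : Fin (suc k) → _
    g′ Fin.zero = x
    g′ (Fin.suc i) = g i
    g′-injective : Injective _≡_ _≡_ g′
    g′-injective {Fin.zero} {Fin.zero} _ = refl
    g′-injective {Fin.zero} {Fin.suc j} x≡gj = ⊥-elim (miss (j , sym x≡gj))
    g′-injective {Fin.suc i} {Fin.zero} gi≡x = ⊥-elim (miss (i , gi≡x))
    g′-injective {Fin.suc i} {Fin.suc j} gi≡gj = cong Fin.suc (g-injective gi≡gj)
    g′-P : ∀ i → P (lookup v (g′ i))
    g′-P Fin.zero = x-P
    g′-P (Fin.suc i) = g-P i


-- shift f ℓ is f (ℓ - 1), and 0 for ℓ = 0: the count of words whose first letter is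
-- marked, in terms of the count for the remaining letters.
shift : (ℕ → ℕ) → ℕ → ℕ
shift f zero = 0
shift f (suc ℓ) = f ℓ

shift-cong : {f g : ℕ → ℕ} (ℓ : ℕ) → (∀ i → f i ≡ g i) → shift f ℓ ≡ shift g ℓ
shift-cong zero f≗g = refl
shift-cong (suc ℓ) f≗g = f≗g ℓ

*-shift : (c : ℕ) (f : ℕ → ℕ) (ℓ : ℕ) → c * shift f ℓ ≡ shift (λ i → c * f i) ℓ
*-shift c f zero = *-zeroʳ c
*-shift c f (suc ℓ) = refl

-- binomPow t m ℓ = (m choose ℓ) · t^(m-ℓ): the number of words of length m with ℓ marked
-- positions and t admissible letters at every other position.
binomPow : ℕ → ℕ → ℕ → ℕ
binomPow t m ℓ = (m C ℓ) * t ^ (m ∸ ℓ)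

-- When (m choose ℓ+1) is nonzero, m - ℓ is a successor; this lets Pascal's rule act on
-- expressions of the form (m choose ℓ+1) · f (m - ℓ).
C-shift : (f : ℕ → ℕ) (m ℓ : ℕ) → (m C suc ℓ) * f (m ∸ ℓ) ≡ (m C suc ℓ) * f (suc (m ∸ suc ℓ))
C-shift f m ℓ with suc ℓ ≤? m
... | yes ℓ<m = cong (λ e → (m C suc ℓ) * f e) (+-∸-assoc 1 ℓ<m)
... | no ℓ≮m rewrite k>n⇒nCk≡0 (≰⇒> ℓ≮m) = refl

-- Pascal's rule for marked words: classify by whether the first position is marked.
binomPow-step : (t m ℓ : ℕ) → binomPow t (suc m) ℓ ≡ shift (binomPow t m) ℓ + t * binomPow t m ℓ
binomPow-step t m zero = trans (*-identityˡ _) (cong (t *_) (sym (*-identityˡ _)))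
binomPow-step t m (suc ℓ) = begin
  (suc m C suc ℓ) * t ^ (m ∸ ℓ)                       ≡⟨ cong (_* t ^ (m ∸ ℓ)) (sym (nCk+nC[k+1]≡[n+1]C[k+1] m ℓ)) ⟩
  ((m C ℓ) + (m C suc ℓ)) * t ^ (m ∸ ℓ)               ≡⟨ *-distribʳ-+ (t ^ (m ∸ ℓ)) (m C ℓ) _ ⟩
  binomPow t m ℓ + (m C suc ℓ) * t ^ (m ∸ ℓ)          ≡⟨ cong (_+_ (binomPow t m ℓ)) (C-shift (t ^_) m ℓ) ⟩
  binomPow t m ℓ + (m C suc ℓ) * (t * t ^ (m ∸ suc ℓ)) ≡⟨ cong (_+_ (binomPow t m ℓ)) (commute (m C suc ℓ) t _) ⟩
  binomPow t m ℓ + t * binomPow t m (suc ℓ)            ∎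
  where
  open ≡-Reasoning
  commute : ∀ c t x → c * (t * x) ≡ t * (c * x)
  commute = solve-∀

-- trinomPow t m ℓ k = (m choose ℓ) (m-ℓ choose k) t^(m-ℓ-k): words of length m with ℓ
-- positions of a first kind, k of a second kind and t admissible letters elsewhere.
trinomPow : ℕ → ℕ → ℕ → ℕ → ℕ
trinomPow t m ℓ k = (m C ℓ) * binomPow t (m ∸ ℓ) k

trinomPow-zero : (t m k : ℕ) → trinomPow t m 0 k ≡ binomPow t m k
trinomPow-zero t m k = *-identityˡ _

-- Pascal's rule for words with two kinds of marks, classifying by the first position.
trinomPow-step : (t m ℓ k : ℕ) →
  trinomPow t (suc m) ℓ k ≡ shift (λ i → trinomPow t m i k) ℓ + shift (trinomPow t m ℓ) k + t * trinomPow t m ℓ k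
trinomPow-step t m zero k = begin
  trinomPow t (suc m) 0 k                       ≡⟨ trinomPow-zero t (suc m) k ⟩
  binomPow t (suc m) k                          ≡⟨ binomPow-step t m k ⟩
  shift (binomPow t m) k + t * binomPow t m k
    ≡⟨ sym (cong₂ (λ x y → x + t * y) (shift-cong k (trinomPow-zero t m)) (trinomPow-zero t m k)) ⟩
  shift (trinomPow t m 0) k + t * trinomPow t m 0 k ∎
  where open ≡-Reasoning
trinomPow-step t m (suc ℓ) k = begin
  (suc m C suc ℓ) * binomPow t (m ∸ ℓ) k
    ≡⟨ cong (_* binomPow t (m ∸ ℓ) k) (sym (nCk+nC[k+1]≡[n+1]C[k+1] m ℓ)) ⟩
  ((m C ℓ) + c) * binomPow t (m ∸ ℓ) k                     ≡⟨ *-distribʳ-+ (binomPow t (m ∸ ℓ) k) (m C ℓ) c ⟩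
  trinomPow t m ℓ k + c * binomPow t (m ∸ ℓ) k
    ≡⟨ cong (_+_ (trinomPow t m ℓ k)) (C-shift (λ e → binomPow t e k) m ℓ) ⟩
  trinomPow t m ℓ k + c * binomPow t (suc M) k             ≡⟨ cong (λ e → trinomPow t m ℓ k + c * e) (binomPow-step t M k) ⟩
  trinomPow t m ℓ k + c * (shift (binomPow t M) k + t * binomPow t M k)
    ≡⟨ cong (_+_ (trinomPow t m ℓ k)) (distribute c t (shift (binomPow t M) k) (binomPow t M k)) ⟩
  trinomPow t m ℓ k + (c * shift (binomPow t M) k + t * trinomPow t m (suc ℓ) k)
    ≡⟨ cong (λ e → trinomPow t m ℓ k + (e + t * trinomPow t m (suc ℓ) k)) (*-shift c (binomPow t M) k) ⟩
  trinomPow t m ℓ k + (shift (trinomPow t m (suc ℓ)) k + t * trinomPow t m (suc ℓ) k)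
    ≡⟨ sym (Data.Nat.Properties.+-assoc (trinomPow t m ℓ k) _ _) ⟩
  trinomPow t m ℓ k + shift (trinomPow t m (suc ℓ)) k + t * trinomPow t m (suc ℓ) k ∎
  where
  open ≡-Reasoning
  c M : ℕ
  c = m C suc ℓ
  M = m ∸ suc ℓ
  distribute : ∀ c t x y → c * (x + t * y) ≡ c * x + t * (c * y)
  distribute = solve-∀


∑-letter : (x : Fin (suc s)) (h : Bool → ℕ) →
  ∑ (allFin (suc s)) (λ y → h (does (y ≟ᶠ x))) ≡ h true + s * h false
∑-letter {s} Fin.zero h =
  trans (∑-allFin-suc {n = s} (λ y → h (does (y ≟ᶠ Fin.zero)))) (cong (_+_ (h true)) (∑-allFin-const s (h false)))
∑-letter {suc s} (Fin.suc x) h =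
  trans (∑-allFin-suc {n = suc s} (λ y → h (does (y ≟ᶠ Fin.suc x))))
        (trans (cong (_+_ (h false)) (∑-letter x h)) (regroup (h true) (h false) s))
  where
  regroup : ∀ a b c → b + (a + c * b) ≡ a + (b + c * b)
  regroup = solve-∀

letterCount : (s m : ℕ) → Fin (suc s) → ℕ → ℕ
letterCount s m x ℓ = ∑ (words (suc s) m) (λ v → 𝟙 (occ x v ≡ᵇ ℓ))

-- Pascal recurrence: split by the first letter, which is either x or one of the s others.
letterCount-step : (s m : ℕ) (x : Fin (suc s)) (ℓ : ℕ) →
  letterCount s (suc m) x ℓ ≡ shift (letterCount s m x) ℓ + s * letterCount s m x ℓ
letterCount-step s m x ℓ =
  trans (∑-words-suc (suc s) m (λ v → 𝟙 (occ x v ≡ᵇ ℓ)))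
        (trans (∑-letter x with-first) (cong (_+ s * letterCount s m x ℓ) (first-is-x ℓ)))
  where
  with-first : Bool → ℕ
  with-first b = ∑ (words (suc s) m) (λ v → 𝟙 ((if b then suc else id) (occ x v) ≡ᵇ ℓ))
  first-is-x : ∀ ℓ → ∑ (words (suc s) m) (λ v → 𝟙 (suc (occ x v) ≡ᵇ ℓ)) ≡ shift (letterCount s m x) ℓ
  first-is-x zero = ∑-zero (words (suc s) m)
  first-is-x (suc ℓ) = refl

letterCount-closed : (s m : ℕ) (x : Fin (suc s)) (ℓ : ℕ) → letterCount s m x ℓ ≡ binomPow s m ℓ
letterCount-closed s zero x zero = refl
letterCount-closed s zero x (suc ℓ) = refl
letterCount-closed s (suc m) x ℓ = begin
  letterCount s (suc m) x ℓ                          ≡⟨ letterCount-step s m x ℓ ⟩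
  shift (letterCount s m x) ℓ + s * letterCount s m x ℓ
    ≡⟨ cong₂ (λ a b → a + s * b) (shift-cong ℓ (letterCount-closed s m x)) (letterCount-closed s m x ℓ) ⟩
  shift (binomPow s m) ℓ + s * binomPow s m ℓ        ≡⟨ sym (binomPow-step s m ℓ) ⟩
  binomPow s (suc m) ℓ                               ∎
  where open ≡-Reasoning

zeroOneCount : (t m ℓ k : ℕ) → ℕ
zeroOneCount t m ℓ k =
  ∑ (words (suc (suc t)) m) (λ v → 𝟙 ((occ Fin.zero v ≡ᵇ ℓ) ∧ (occ one v ≡ᵇ k)))

-- Pascal recurrence: split by the first letter, which is 0, 1 or one of the t others.
zeroOneCount-step : (t m ℓ k : ℕ) →
  zeroOneCount t (suc m) ℓ k ≡
  shift (λ i → zeroOneCount t m i k) ℓ + shift (zeroOneCount t m ℓ) k + t * zeroOneCount t m ℓ k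
zeroOneCount-step t m ℓ k = begin
  zeroOneCount t (suc m) ℓ k                                      ≡⟨ ∑-words-first t m f ⟩
  first-zero ℓ + (first-one k + ∑ (allFin t) (λ _ → zeroOneCount t m ℓ k))
    ≡⟨ cong (λ e → first-zero ℓ + (first-one k + e)) (∑-allFin-const t _) ⟩
  first-zero ℓ + (first-one k + t * zeroOneCount t m ℓ k)         ≡⟨ sym (+-assoc (first-zero ℓ) _ _) ⟩
  first-zero ℓ + first-one k + t * zeroOneCount t m ℓ k
    ≡⟨ cong₂ (λ a b → a + b + t * zeroOneCount t m ℓ k) (first-zero-shift ℓ) (first-one-shift k) ⟩
  shift (λ i → zeroOneCount t m i k) ℓ + shift (zeroOneCount t m ℓ) k + t * zeroOneCount t m ℓ k ∎
  where
  open ≡-Reasoning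
  W : List (Vec (Fin (suc (suc t))) m)
  W = words (suc (suc t)) m
  f : Vec (Fin (suc (suc t))) (suc m) → ℕ
  f v = 𝟙 ((occ Fin.zero v ≡ᵇ ℓ) ∧ (occ one v ≡ᵇ k))
  first-zero : ℕ → ℕ
  first-zero ℓ = ∑ W (λ v → 𝟙 ((suc (occ Fin.zero v) ≡ᵇ ℓ) ∧ (occ one v ≡ᵇ k)))
  first-one : ℕ → ℕ
  first-one k = ∑ W (λ v → 𝟙 ((occ Fin.zero v ≡ᵇ ℓ) ∧ (suc (occ one v) ≡ᵇ k)))
  first-zero-shift : ∀ ℓ → first-zero ℓ ≡ shift (λ i → zeroOneCount t m i k) ℓ
  first-zero-shift zero = ∑-zero W
  first-zero-shift (suc ℓ) = refl
  first-one-shift : ∀ k → first-one k ≡ shift (zeroOneCount t m ℓ) k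
  first-one-shift zero = trans (∑-cong W (λ v _ → cong 𝟙 (∧-zeroʳ (occ Fin.zero v ≡ᵇ ℓ)))) (∑-zero W)
  first-one-shift (suc k) = refl

zeroOneCount-closed : (t m ℓ k : ℕ) → zeroOneCount t m ℓ k ≡ trinomPow t m ℓ k
zeroOneCount-closed t zero zero zero = refl
zeroOneCount-closed t zero zero (suc k) = refl
zeroOneCount-closed t zero (suc ℓ) k = refl
zeroOneCount-closed t (suc m) ℓ k = begin
  zeroOneCount t (suc m) ℓ k ≡⟨ zeroOneCount-step t m ℓ k ⟩
  shift (λ i → zeroOneCount t m i k) ℓ + shift (zeroOneCount t m ℓ) k + t * zeroOneCount t m ℓ k
    ≡⟨ cong₂ _+_ (cong₂ _+_ (shift-cong ℓ (λ i → zeroOneCount-closed t m i k)) (shift-cong k (zeroOneCount-closed t m ℓ)))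
                 (cong (t *_) (zeroOneCount-closed t m ℓ k)) ⟩
  shift (λ i → trinomPow t m i k) ℓ + shift (trinomPow t m ℓ) k + t * trinomPow t m ℓ k
    ≡⟨ sym (trinomPow-step t m ℓ k) ⟩
  trinomPow t (suc m) ℓ k ∎
  where open ≡-Reasoning


kind : Fin (suc (suc t)) → Fin 3
kind Fin.zero = Fin.zero
kind (Fin.suc Fin.zero) = Fin.suc Fin.zero
kind (Fin.suc (Fin.suc _)) = two

kind-zero : (y : Fin (suc (suc t))) → kind y ≡ Fin.zero → y ≡ Fin.zero
kind-zero Fin.zero _ = refl
kind-zero (Fin.suc Fin.zero) ()
kind-zero (Fin.suc (Fin.suc _)) ()

kind-one : (y : Fin (suc (suc t))) → kind y ≡ one → y ≡ one
kind-one Fin.zero ()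
kind-one (Fin.suc Fin.zero) _ = refl
kind-one (Fin.suc (Fin.suc _)) ()

kind-agree : (y y′ : Fin (suc (suc t))) → (y ≡ Fin.zero → y′ ≡ Fin.zero) → (y′ ≡ Fin.zero → y ≡ Fin.zero) →
  (y ≡ one → y′ ≡ one) → (y′ ≡ one → y ≡ one) → kind y ≡ kind y′
kind-agree Fin.zero y′ zero→ _ _ _ rewrite zero→ refl = refl
kind-agree (Fin.suc Fin.zero) y′ _ _ one→ _ rewrite one→ refl = refl
kind-agree (Fin.suc (Fin.suc _)) Fin.zero _ zero← _ _ with () ← zero← refl
kind-agree (Fin.suc (Fin.suc _)) (Fin.suc Fin.zero) _ _ _ one← with () ← one← refl
kind-agree (Fin.suc (Fin.suc _)) (Fin.suc (Fin.suc _)) _ _ _ _ = refl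

shape : Vec (Fin (suc (suc t))) m → Vec (Fin 3) m
shape = Vec.map kind

shape-zeros : (v : Vec (Fin (suc (suc t))) m) → occ Fin.zero (shape v) ≡ occ Fin.zero v
shape-zeros [] = refl
shape-zeros (Fin.zero ∷ v) = cong suc (shape-zeros v)
shape-zeros (Fin.suc Fin.zero ∷ v) = shape-zeros v
shape-zeros (Fin.suc (Fin.suc _) ∷ v) = shape-zeros v

shape-ones : (v : Vec (Fin (suc (suc t))) m) → occ one (shape v) ≡ occ one v
shape-ones [] = refl
shape-ones (Fin.zero ∷ v) = shape-ones v
shape-ones (Fin.suc Fin.zero ∷ v) = cong suc (shape-ones v)
shape-ones (Fin.suc (Fin.suc _) ∷ v) = shape-ones v

_≟ˢ_ : DecidableEquality (Vec (Fin 3) m)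
_≟ˢ_ = Data.Vec.Properties.≡-dec _≟ᶠ_

-- A shape q is the shape of exactly t^(number of 2s in q) words: each 0 and 1 of q is forced,
-- each 2 can be any of the t other letters.
shapeCount : (t : ℕ) (q : Vec (Fin 3) m) →
  ∑ (words (suc (suc t)) m) (λ v → 𝟙 (does (shape v ≟ˢ q))) ≡ t ^ occ two q
shapeCount t [] = refl
shapeCount {suc m} t (y ∷ q) = trans (∑-words-first t m _) (by-first-letter y)
  where
  W : List (Vec (Fin (suc (suc t))) m)
  W = words (suc (suc t)) m
  N : ℕ
  N = ∑ W (λ v → 𝟙 (does (shape v ≟ˢ q)))
  none : ∑ (allFin t) (λ _ → ∑ W (λ _ → 0)) ≡ 0
  none = trans (∑-cong (allFin t) (λ _ _ → ∑-zero W)) (∑-zero (allFin t))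
  by-first-letter : ∀ y →
    ∑ W (λ v → 𝟙 (does (shape (Fin.zero ∷ v) ≟ˢ (y ∷ q)))) +
    (∑ W (λ v → 𝟙 (does (shape (Fin.suc Fin.zero ∷ v) ≟ˢ (y ∷ q)))) +
     ∑ (allFin t) (λ z → ∑ W (λ v → 𝟙 (does (shape (Fin.suc (Fin.suc z) ∷ v) ≟ˢ (y ∷ q)))))) ≡
    t ^ occ two (y ∷ q)
  by-first-letter Fin.zero =
    trans (cong₂ (λ a b → N + (a + b)) (∑-zero W) none) (trans (+-identityʳ N) (shapeCount t q))
  by-first-letter (Fin.suc Fin.zero) =
    trans (cong₂ (λ a b → a + (N + b)) (∑-zero W) none) (trans (+-identityʳ N) (shapeCount t q))
  by-first-letter (Fin.suc (Fin.suc Fin.zero)) =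
    trans (cong₂ (λ a b → a + (b + ∑ (allFin t) (λ _ → N))) (∑-zero W) (∑-zero W))
          (trans (∑-allFin-const t N) (cong (t *_) (shapeCount t q)))

occ-total : (q : Vec (Fin 3) m) → occ Fin.zero q + occ one q + occ two q ≡ m
occ-total [] = refl
occ-total (Fin.zero ∷ q) = cong suc (occ-total q)
occ-total (Fin.suc Fin.zero ∷ q) = trans (cong (_+ occ two q) (+-suc (occ Fin.zero q) _)) (cong suc (occ-total q))
occ-total (Fin.suc (Fin.suc Fin.zero) ∷ q) = trans (+-suc _ (occ two q)) (cong suc (occ-total q))


light : {n : ℕ} → ℕ → ℕ → Vec (Fin (suc (suc n))) m → Bool
light a b v = (occ Fin.zero v <ᵇ a) ∨ (occ one v <ᵇ b)

heavy-zeros : (a b : ℕ) (v : Vec (Fin (suc (suc t))) m) → light a b v ≡ false → a ≤ occ Fin.zero v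
heavy-zeros a b v is-heavy with occ Fin.zero v <ᵇ a in few
heavy-zeros a b v () | true
... | false = ≮⇒≥ (λ lt → subst T few (<⇒<ᵇ lt))

heavy-ones : (a b : ℕ) (v : Vec (Fin (suc (suc t))) m) → light a b v ≡ false → b ≤ occ one v
heavy-ones a b v is-heavy with occ Fin.zero v <ᵇ a | occ one v <ᵇ b in few
heavy-ones a b v () | true | _
heavy-ones a b v () | false | true
... | false | false = ≮⇒≥ (λ lt → subst T few (<⇒<ᵇ lt))

enough⇒heavy : (a b : ℕ) (v : Vec (Fin (suc (suc t))) m) → a ≤ occ Fin.zero v → b ≤ occ one v → light a b v ≡ false
enough⇒heavy a b v a≤ b≤ with occ Fin.zero v <ᵇ a in few-zeros | occ one v <ᵇ b in few-ones
... | true | _ = ⊥-elim (<⇒≱ (<ᵇ⇒< _ a (subst T (sym few-zeros) _)) a≤)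
... | false | true = ⊥-elim (<⇒≱ (<ᵇ⇒< _ b (subst T (sym few-ones) _)) b≤)
... | false | false = refl

lightWords : (t m a b : ℕ) → List (Vec (Fin (suc (suc t))) m)
lightWords t m a b = filterᵇ (light a b) (words (suc (suc t)) m)

light-member : (t m a b : ℕ) {v : Vec (Fin (suc (suc t))) m} → v ∈ lightWords t m a b → T (light a b v)
light-member t m a b v∈ = proj₂ (∈-filter⁻ (T? ∘ light a b) {xs = words (suc (suc t)) m} v∈)

-- Shapes with exactly a zeros and b ones: the possible traces of heavy words.
isShape : ℕ → ℕ → Vec (Fin 3) m → Bool
isShape a b q = (occ Fin.zero q ≡ᵇ a) ∧ (occ one q ≡ᵇ b)

shapes : (m a b : ℕ) → List (Vec (Fin 3) m)
shapes m a b = filterᵇ (isShape a b) (words 3 m)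

shape-sizes : (a b : ℕ) (q : Vec (Fin 3) m) → T (isShape a b q) → occ Fin.zero q ≡ a × occ one q ≡ b
shape-sizes a b q is-shape =
  let (zeros , ones) = Equivalence.to T-∧ is-shape in ≡ᵇ⇒≡ _ a zeros , ≡ᵇ⇒≡ _ b ones

shapes-member : (m a b : ℕ) {q : Vec (Fin 3) m} → q ∈ shapes m a b → occ Fin.zero q ≡ a × occ one q ≡ b
shapes-member m a b {q} q∈ = shape-sizes a b q (proj₂ (∈-filter⁻ (T? ∘ isShape a b) {xs = words 3 m} q∈))

shape-twos : (a b : ℕ) (q : Vec (Fin 3) m) → occ Fin.zero q ≡ a → occ one q ≡ b → occ two q ≡ m ∸ a ∸ b
shape-twos {m} a b q zeros≡a ones≡b = sym (begin
  m ∸ a ∸ b                                      ≡⟨ cong (λ e → e ∸ a ∸ b) (sym (occ-total q)) ⟩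
  occ Fin.zero q + occ one q + occ two q ∸ a ∸ b ≡⟨ cong (λ e → e + occ two q ∸ a ∸ b) (cong₂ _+_ zeros≡a ones≡b) ⟩
  a + b + occ two q ∸ a ∸ b                      ≡⟨ cong (λ e → e ∸ a ∸ b) (+-assoc a b _) ⟩
  a + (b + occ two q) ∸ a ∸ b                    ≡⟨ cong (_∸ b) (m+n∸m≡n a _) ⟩
  b + occ two q ∸ b                              ≡⟨ m+n∸m≡n b _ ⟩
  occ two q                                      ∎)
  where open ≡-Reasoning


-- trace v α β keeps the first α zeros and the first β ones of v and turns every other
-- letter into 2.  A heavy column is charged to its trace, which is a shape with exactly
-- a zeros and b ones.
trace : Vec (Fin (suc (suc t))) m → ℕ → ℕ → Vec (Fin 3) m
trace [] α β = []
trace (Fin.zero ∷ v) (suc α) β = Fin.zero ∷ trace v α β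
trace (Fin.zero ∷ v) zero β = two ∷ trace v zero β
trace (Fin.suc Fin.zero ∷ v) α (suc β) = one ∷ trace v α β
trace (Fin.suc Fin.zero ∷ v) α zero = two ∷ trace v α zero
trace (Fin.suc (Fin.suc _) ∷ v) α β = two ∷ trace v α β

trace-zeros : (v : Vec (Fin (suc (suc t))) m) (α β : ℕ) → α ≤ occ Fin.zero v → occ Fin.zero (trace v α β) ≡ α
trace-zeros [] zero β _ = refl
trace-zeros (Fin.zero ∷ v) (suc α) β (s≤s α≤) = cong suc (trace-zeros v α β α≤)
trace-zeros (Fin.zero ∷ v) zero β _ = trace-zeros v zero β z≤n
trace-zeros (Fin.suc Fin.zero ∷ v) α (suc β) α≤ = trace-zeros v α β α≤
trace-zeros (Fin.suc Fin.zero ∷ v) α zero α≤ = trace-zeros v α zero α≤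
trace-zeros (Fin.suc (Fin.suc _) ∷ v) α β α≤ = trace-zeros v α β α≤

trace-ones : (v : Vec (Fin (suc (suc t))) m) (α β : ℕ) → β ≤ occ one v → occ one (trace v α β) ≡ β
trace-ones [] α zero _ = refl
trace-ones (Fin.zero ∷ v) (suc α) β β≤ = trace-ones v α β β≤
trace-ones (Fin.zero ∷ v) zero β β≤ = trace-ones v zero β β≤
trace-ones (Fin.suc Fin.zero ∷ v) α (suc β) (s≤s β≤) = cong suc (trace-ones v α β β≤)
trace-ones (Fin.suc Fin.zero ∷ v) α zero _ = trace-ones v α zero z≤n
trace-ones (Fin.suc (Fin.suc _) ∷ v) α β β≤ = trace-ones v α β β≤

trace-sound : (v : Vec (Fin (suc (suc t))) m) (α β : ℕ) (x : Fin m) →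
  lookup (trace v α β) x ≢ two → kind (lookup v x) ≡ lookup (trace v α β) x
trace-sound (Fin.zero ∷ v) (suc α) β Fin.zero _ = refl
trace-sound (Fin.zero ∷ v) (suc α) β (Fin.suc x) ≢two = trace-sound v α β x ≢two
trace-sound (Fin.zero ∷ v) zero β Fin.zero ≢two = ⊥-elim (≢two refl)
trace-sound (Fin.zero ∷ v) zero β (Fin.suc x) ≢two = trace-sound v zero β x ≢two
trace-sound (Fin.suc Fin.zero ∷ v) α (suc β) Fin.zero _ = refl
trace-sound (Fin.suc Fin.zero ∷ v) α (suc β) (Fin.suc x) ≢two = trace-sound v α β x ≢two
trace-sound (Fin.suc Fin.zero ∷ v) α zero Fin.zero ≢two = ⊥-elim (≢two refl)
trace-sound (Fin.suc Fin.zero ∷ v) α zero (Fin.suc x) ≢two = trace-sound v α zero x ≢two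
trace-sound (Fin.suc (Fin.suc _) ∷ v) α β Fin.zero ≢two = ⊥-elim (≢two refl)
trace-sound (Fin.suc (Fin.suc _) ∷ v) α β (Fin.suc x) ≢two = trace-sound v α β x ≢two

trace-shape : (a b : ℕ) (v : Vec (Fin (suc (suc t))) m) → light a b v ≡ false → T (isShape a b (trace v a b))
trace-shape a b v is-heavy
  rewrite trace-zeros v a b (heavy-zeros a b v is-heavy) | trace-ones v a b (heavy-ones a b v is-heavy)
  = Equivalence.from T-∧ (≡⇒≡ᵇ a a refl , ≡⇒≡ᵇ b b refl)


record Copy {m n r : ℕ} (A : Matrix m n r) (a b p : ℕ) : Set where
  field
    zeroRow : Fin a → Fin m
    oneRow : Fin b → Fin m
    column : Fin p → Fin n
    zeroRow-injective : Injective _≡_ _≡_ zeroRow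
    oneRow-injective : Injective _≡_ _≡_ oneRow
    column-injective : Injective _≡_ _≡_ column
    zero-entries : ∀ i j → toℕ (A (zeroRow i) (column j)) ≡ 0
    one-entries : ∀ i j → toℕ (A (oneRow i) (column j)) ≡ 1

F-top : (a b p : ℕ) (i : Fin a) (j : Fin p) → F a b p (i ↑ˡ b) j ≡ 0
F-top a b p i j rewrite toℕ-↑ˡ i b | dec-true (toℕ i <? a) (toℕ<n i) = refl

F-bottom : (a b p : ℕ) (i : Fin b) (j : Fin p) → F a b p (a ↑ʳ i) j ≡ 1
F-bottom a b p i j rewrite toℕ-↑ʳ a i | dec-false (a + toℕ i <? a) (λ lt → <⇒≱ lt (m≤m+n a (toℕ i))) = refl

module _ {m n r a b : ℕ} {A : Matrix m n r} where

  contains⇒copy : {p : ℕ} → Contains A (F a b p) → Copy A a b p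
  contains⇒copy {p} (σ , τ , σ-injective , τ-injective , entries) = record
    { zeroRow = λ i → σ (i ↑ˡ b)
    ; oneRow = λ i → σ (a ↑ʳ i)
    ; column = τ
    ; zeroRow-injective = λ eq → ↑ˡ-injective b _ _ (σ-injective eq)
    ; oneRow-injective = λ eq → ↑ʳ-injective a _ _ (σ-injective eq)
    ; column-injective = τ-injective
    ; zero-entries = λ i j → trans (entries (i ↑ˡ b) j) (F-top a b p i j)
    ; one-entries = λ i j → trans (entries (a ↑ʳ i) j) (F-bottom a b p i j)
    }

  -- With at least one column, the zero rows and one rows of a copy are automatically distinct.
  copy⇒contains : {p : ℕ} → Copy A a b (suc p) → Contains A (F a b (suc p))
  copy⇒contains {p} c = σ , column , σ-injective , column-injective , entries
    where
    open Copy c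
    σ : Fin (a + b) → Fin m
    σ i = [ zeroRow , oneRow ]′ (splitAt a i)
    rows-disjoint : ∀ i i′ → zeroRow i ≢ oneRow i′
    rows-disjoint i i′ eq with () ← trans (sym (zero-entries i Fin.zero))
                                   (trans (cong (λ x → toℕ (A x (column Fin.zero))) eq) (one-entries i′ Fin.zero))
    σ-injective : Injective _≡_ _≡_ σ
    σ-injective {i} {i′} eq with splitAt a i in e | splitAt a i′ in e′
    ... | inj₁ k | inj₁ k′ =
      trans (sym (splitAt⁻¹-↑ˡ e)) (trans (cong (_↑ˡ b) (zeroRow-injective eq)) (splitAt⁻¹-↑ˡ e′))
    ... | inj₂ k | inj₂ k′ =
      trans (sym (splitAt⁻¹-↑ʳ e)) (trans (cong (a ↑ʳ_) (oneRow-injective eq)) (splitAt⁻¹-↑ʳ e′))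
    ... | inj₁ k | inj₂ k′ = ⊥-elim (rows-disjoint k k′ eq)
    ... | inj₂ k | inj₁ k′ = ⊥-elim (rows-disjoint k′ k (sym eq))
    entries : ∀ i j → toℕ (A (σ i) (column j)) ≡ F a b (suc p) i j
    entries i j with splitAt a i in e
    ... | inj₁ k = trans (zero-entries k j)
                     (sym (trans (cong (λ i → F a b (suc p) i j) (sym (splitAt⁻¹-↑ˡ e))) (F-top a b (suc p) k j)))
    ... | inj₂ k = trans (one-entries k j)
                     (sym (trans (cong (λ i → F a b (suc p) i j) (sym (splitAt⁻¹-↑ʳ e))) (F-bottom a b (suc p) k j)))


columnWord : Matrix m n r → Fin n → Vec (Fin r) m
columnWord A j = tabulate (λ i → A i j)

simple⇒columns-distinct : (A : Matrix m n r) → Simple A → Injective _≡_ _≡_ (columnWord A)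
simple⇒columns-distinct A simple {j} {j′} same-word with j ≟ᶠ j′
... | yes j≡j′ = j≡j′
... | no j≢j′ =
  let (i , differ) = simple j j′ j≢j′
  in ⊥-elim (differ (trans (sym (lookup∘tabulate _ i)) (trans (cong (λ c → lookup c i) same-word) (lookup∘tabulate _ i))))

-- p distinct columns agreeing with a shape q (with a zeros and b ones) at every position
-- where q shows 0 or 1 form a copy of F(a,b,p): take the zero and one positions of q as rows.
shape-copy : {a b p : ℕ} (A : Matrix m n (suc (suc t))) (q : Vec (Fin 3) m) →
  occ Fin.zero q ≡ a → occ one q ≡ b → (τ : Fin p → Fin n) → Injective _≡_ _≡_ τ →
  (∀ j x → lookup q x ≢ two → kind (A x (τ j)) ≡ lookup q x) → Copy A a b p
shape-copy A q zeros≡a ones≡b τ τ-injective agrees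
  with enumerate (_≟ᶠ Fin.zero) q zeros≡a | enumerate (_≟ᶠ one) q ones≡b
... | Z , Z-injective , Z-zero | O , O-injective , O-one = record
  { zeroRow = Z
  ; oneRow = O
  ; column = τ
  ; zeroRow-injective = Z-injective
  ; oneRow-injective = O-injective
  ; column-injective = τ-injective
  ; zero-entries = λ i j →
      cong toℕ (kind-zero _ (trans (agrees j (Z i) (λ eq → zero≢two (trans (sym (Z-zero i)) eq))) (Z-zero i)))
  ; one-entries = λ i j →
      cong toℕ (kind-one _ (trans (agrees j (O i) (λ eq → one≢two (trans (sym (O-one i)) eq))) (O-one i)))
  }
  where
  zero≢two : Fin.zero ≢ two
  zero≢two ()
  one≢two : one ≢ two
  one≢two ()

charge : (a b : ℕ) → Vec (Fin (suc (suc t))) m → Vec (Fin (suc (suc t))) m ⊎ Vec (Fin 3) m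
charge a b v = if light a b v then inj₁ v else inj₂ (trace v a b)

charge-inj₁ : (a b : ℕ) (v w : Vec (Fin (suc (suc t))) m) → charge a b v ≡ inj₁ w → v ≡ w
charge-inj₁ a b v w eq with light a b v
charge-inj₁ a b v w refl | true = refl
charge-inj₁ a b v w () | false

charge-inj₂ : (a b : ℕ) (v : Vec (Fin (suc (suc t))) m) (q : Vec (Fin 3) m) →
  charge a b v ≡ inj₂ q → light a b v ≡ false × trace v a b ≡ q
charge-inj₂ a b v q eq with light a b v
charge-inj₂ a b v q () | true
charge-inj₂ a b v q refl | false = refl , refl

charges : (t m a b : ℕ) → List (Vec (Fin (suc (suc t))) m ⊎ Vec (Fin 3) m)
charges t m a b = map inj₁ (lightWords t m a b) ++ map inj₂ (shapes m a b)

charge∈charges : (a b : ℕ) (v : Vec (Fin (suc (suc t))) m) → charge a b v ∈ charges t m a b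
charge∈charges {t} {m} a b v with light a b v in is-light
... | true = ∈-++⁺ˡ (∈-map⁺ inj₁ (∈-filter⁺ (T? ∘ light a b) (∈-words v) (subst T (sym is-light) _)))
... | false = ∈-++⁺ʳ (map inj₁ (lightWords t m a b))
                (∈-map⁺ inj₂ (∈-filter⁺ (T? ∘ isShape a b) (∈-words _) (trace-shape a b v is-light)))

-- Upper bound: a simple matrix avoiding F(a,b,1+p′) has at most one column per light word
-- and at most p′ columns charged to each shape.
upper-bound : (t m a b p′ : ℕ) {n : ℕ} (A : Matrix m n (suc (suc t))) → Simple A → Avoids A (F a b (suc p′)) →
  n ≤ length (lightWords t m a b) + length (shapes m a b) * p′
upper-bound t m a b p′ {n} A simple avoids = begin
  n                              ≤⟨ fibre-bound _≟_ (charge a b ∘ columnWord A) (charges t m a b) bound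
                                      (λ j → charge∈charges a b (columnWord A j)) no-large-fibre ⟩
  ∑ (charges t m a b) bound      ≡⟨ ∑-++ (map inj₁ (lightWords t m a b)) _ bound ⟩
  ∑ (map inj₁ (lightWords t m a b)) bound + ∑ (map inj₂ (shapes m a b)) bound
    ≡⟨ cong₂ _+_ (trans (∑-map inj₁ (lightWords t m a b) bound) (trans (∑-const (lightWords t m a b) 1) (*-identityʳ _)))
                 (trans (∑-map inj₂ (shapes m a b) bound) (∑-const (shapes m a b) p′)) ⟩
  length (lightWords t m a b) + length (shapes m a b) * p′ ∎
  where
  open Data.Nat.Properties.≤-Reasoning
  Word : Set
  Word = Vec (Fin (suc (suc t))) m
  _≟_ : DecidableEquality (Word ⊎ Vec (Fin 3) m)
  _≟_ = Data.Sum.Properties.≡-dec (Data.Vec.Properties.≡-dec _≟ᶠ_) _≟ˢ_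
  bound : Word ⊎ Vec (Fin 3) m → ℕ
  bound (inj₁ _) = 1
  bound (inj₂ _) = p′
  no-large-fibre : ∀ y (τ : Fin (suc (bound y)) → Fin n) → Injective _≡_ _≡_ τ →
    (∀ i → charge a b (columnWord A (τ i)) ≡ y) → ⊥
  no-large-fibre (inj₁ w) τ τ-injective charged with () ←
    τ-injective {Fin.zero} {Fin.suc Fin.zero} (simple⇒columns-distinct A simple
      (trans (charge-inj₁ a b (columnWord A (τ Fin.zero)) w (charged Fin.zero))
             (sym (charge-inj₁ a b (columnWord A (τ (Fin.suc Fin.zero))) w (charged (Fin.suc Fin.zero))))))
  no-large-fibre (inj₂ q) τ τ-injective charged =
    avoids (copy⇒contains (shape-copy A q zeros≡a ones≡b τ τ-injective agrees))
    where
    is-shape : T (isShape a b q)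
    is-shape with charge-inj₂ a b (columnWord A (τ Fin.zero)) q (charged Fin.zero)
    ... | is-heavy , refl = trace-shape a b (columnWord A (τ Fin.zero)) is-heavy
    zeros≡a : occ Fin.zero q ≡ a
    zeros≡a = proj₁ (shape-sizes a b q is-shape)
    ones≡b : occ one q ≡ b
    ones≡b = proj₂ (shape-sizes a b q is-shape)
    agrees : ∀ j x → lookup q x ≢ two → kind (A x (τ j)) ≡ lookup q x
    agrees j x ≢two with charge-inj₂ a b (columnWord A (τ j)) q (charged j)
    ... | _ , refl = trans (cong kind (sym (lookup∘tabulate (λ i → A i (τ j)) x))) (trace-sound (columnWord A (τ j)) a b x ≢two)


toMatrix : (ws : List (Vec (Fin r) m)) → Matrix m (length ws) r
toMatrix ws i j = lookup (List.lookup ws j) i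

toMatrix-simple : {ws : List (Vec (Fin r) m)} → Unique ws → Simple (toMatrix ws)
toMatrix-simple {m = m} {ws = ws} unique j j′ j≢j′ =
  ¬∀⟶∃¬ m (λ i → toMatrix ws i j ≡ toMatrix ws i j′) (λ i → toMatrix ws i j ≟ᶠ toMatrix ws i j′)
    (λ same → j≢j′ (lookup-injective unique (word-ext same)))

Marked : {a b : ℕ} → (Fin a → Fin m) → (Fin b → Fin m) → Vec (Fin (suc (suc t))) m → Set
Marked Z O v = (∀ i → lookup v (Z i) ≡ Fin.zero) × (∀ i → lookup v (O i) ≡ one)

-- Words with exactly a zeros and b ones that are marked by the same injective families of a
-- and b rows have all their zeros and ones at those rows, hence the same shape.
marked-same-shape : {m t a b : ℕ} (Z : Fin a → Fin m) (O : Fin b → Fin m) → Injective _≡_ _≡_ Z → Injective _≡_ _≡_ O →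
  (v w : Vec (Fin (suc (suc t))) m) → Marked Z O v → Marked Z O w →
  occ Fin.zero v ≡ a × occ one v ≡ b → occ Fin.zero w ≡ a × occ one w ≡ b → shape v ≡ shape w
marked-same-shape {m} {t} {a} {b} Z O Z-injective O-injective v w v-marked w-marked v-sizes w-sizes = word-ext λ x → begin
  lookup (shape v) x   ≡⟨ lookup-map x kind v ⟩
  kind (lookup v x)    ≡⟨ kind-agree _ _ (zero-moves v w v-marked w-marked v-sizes x) (zero-moves w v w-marked v-marked w-sizes x)
                                         (one-moves v w v-marked w-marked v-sizes x) (one-moves w v w-marked v-marked w-sizes x) ⟩
  kind (lookup w x)    ≡⟨ lookup-map x kind w ⟨
  lookup (shape w) x   ∎
  where
  open ≡-Reasoning
  zero-moves : (u u′ : Vec (Fin (suc (suc t))) m) → Marked Z O u → Marked Z O u′ → occ Fin.zero u ≡ a × occ one u ≡ b →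
    ∀ x → lookup u x ≡ Fin.zero → lookup u′ x ≡ Fin.zero
  zero-moves u u′ (u-zeros , _) (u′-zeros , _) (u-zero-count , _) x is-zero
    with exhaust (_≟ᶠ Fin.zero) u Z Z-injective u-zeros u-zero-count x is-zero
  ... | i , refl = u′-zeros i
  one-moves : (u u′ : Vec (Fin (suc (suc t))) m) → Marked Z O u → Marked Z O u′ → occ Fin.zero u ≡ a × occ one u ≡ b →
    ∀ x → lookup u x ≡ one → lookup u′ x ≡ one
  one-moves u u′ (_ , u-ones) (_ , u′-ones) (_ , u-one-count) x is-one
    with exhaust (_≟ᶠ one) u O O-injective u-ones u-one-count x is-one
  ... | i , refl = u′-ones i

block : (t m p′ : ℕ) → Vec (Fin 3) m → List (Vec (Fin (suc (suc t))) m)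
block t m p′ q = take p′ (filter (λ v → shape v ≟ˢ q) (words (suc (suc t)) m))

block-shape : (t m p′ : ℕ) (q : Vec (Fin 3) m) {v : Vec (Fin (suc (suc t))) m} → v ∈ block t m p′ q → shape v ≡ q
block-shape t m p′ q v∈ =
  proj₂ (∈-filter⁻ (λ v → shape v ≟ˢ q) {xs = words (suc (suc t)) m} (Sublist.lookup (take-⊆ p′ _) v∈))

block-unique : (t m p′ : ℕ) (q : Vec (Fin 3) m) → Unique (block t m p′ q)
block-unique t m p′ q = take⁺ p′ (filter⁺ (λ v → shape v ≟ˢ q) (words-unique (suc (suc t)) m))

block-short : (t m p′ : ℕ) (q : Vec (Fin 3) m) → length (block t m p′ q) ≤ p′
block-short t m p′ q rewrite length-take p′ (filter (λ v → shape v ≟ˢ q) (words (suc (suc t)) m)) = m⊓n≤m p′ _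

-- By shapeCount and shape-twos, a shape is the shape of t^(m-a-b) ≥ p′ words, so its block is full.
block-full : (t m a b p′ : ℕ) → p′ ≤ t ^ (m ∸ a ∸ b) → (q : Vec (Fin 3) m) → q ∈ shapes m a b →
  length (block t m p′ q) ≡ p′
block-full t m a b p′ p′≤ q q∈shapes = begin
  length (block t m p′ q)                      ≡⟨ length-take p′ (filter (λ v → shape v ≟ˢ q) W) ⟩
  p′ ⊓ length (filter (λ v → shape v ≟ˢ q) W)
    ≡⟨ cong (p′ ⊓_) (trans (length-filter (λ v → shape v ≟ˢ q) W) (shapeCount t q)) ⟩
  p′ ⊓ t ^ occ two q                           ≡⟨ cong (λ e → p′ ⊓ t ^ e) (shape-twos a b q zeros≡a ones≡b) ⟩
  p′ ⊓ t ^ (m ∸ a ∸ b)                         ≡⟨ m≤n⇒m⊓n≡m p′≤ ⟩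
  p′                                           ∎
  where
  open ≡-Reasoning
  W : List (Vec (Fin (suc (suc t))) m)
  W = words (suc (suc t)) m
  zeros≡a : occ Fin.zero q ≡ a
  zeros≡a = proj₁ (shapes-member m a b q∈shapes)
  ones≡b : occ one q ≡ b
  ones≡b = proj₂ (shapes-member m a b q∈shapes)

extremal : (t m a b p′ : ℕ) → List (Vec (Fin (suc (suc t))) m)
extremal t m a b p′ = lightWords t m a b ++ concatMap (block t m p′) (shapes m a b)

blocked-sizes : (t m a b p′ : ℕ) {v : Vec (Fin (suc (suc t))) m} → v ∈ concatMap (block t m p′) (shapes m a b) →
  occ Fin.zero v ≡ a × occ one v ≡ b
blocked-sizes t m a b p′ {v} v∈ with find (∈-concatMap⁻ (block t m p′) {xs = shapes m a b} v∈)
... | q , q∈shapes , v∈block with block-shape t m p′ q v∈block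
... | refl = let (zeros≡a , ones≡b) = shapes-member m a b q∈shapes
             in trans (sym (shape-zeros v)) zeros≡a , trans (sym (shape-ones v)) ones≡b

-- The extremal list has no repetitions: light words are not in the blocks, which are
-- themselves disjoint because they have different shapes.
extremal-unique : (t m a b p′ : ℕ) → Unique (extremal t m a b p′)
extremal-unique t m a b p′ =
  ++⁺ (filter⁺ (T? ∘ light a b) (words-unique (suc (suc t)) m))
      (concatMap-unique (block t m p′) shape (block-shape t m p′) (block-unique t m p′)
        (filter⁺ (T? ∘ isShape a b) (words-unique 3 m)))
      light-and-blocked
  where
  light-and-blocked : ∀ {v} → v ∈ lightWords t m a b × v ∈ concatMap (block t m p′) (shapes m a b) → ⊥
  light-and-blocked {v} (v∈light , v∈blocks) =
    let (zeros≡a , ones≡b) = blocked-sizes t m a b p′ v∈blocks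
    in subst T (enough⇒heavy a b v (≤-reflexive (sym zeros≡a)) (≤-reflexive (sym ones≡b))) (light-member t m a b v∈light)

extremal-length : (t m a b p′ : ℕ) → p′ ≤ t ^ (m ∸ a ∸ b) →
  length (extremal t m a b p′) ≡ length (lightWords t m a b) + length (shapes m a b) * p′
extremal-length t m a b p′ p′≤ =
  trans (length-++ (lightWords t m a b)) (cong (_+_ (length (lightWords t m a b))) (begin
    length (concatMap (block t m p′) S)                  ≡⟨ length-as-∑ (concatMap (block t m p′) S) ⟩
    ∑ (concatMap (block t m p′) S) (λ _ → 1)             ≡⟨ ∑-concatMap (block t m p′) S (λ _ → 1) ⟩
    ∑ S (λ q → ∑ (block t m p′ q) (λ _ → 1))
      ≡⟨ ∑-cong S (λ q q∈S → trans (sym (length-as-∑ (block t m p′ q))) (block-full t m a b p′ p′≤ q q∈S)) ⟩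
    ∑ S (λ _ → p′)                                       ≡⟨ ∑-const S p′ ⟩
    length S * p′                                        ∎))
  where
  open ≡-Reasoning
  S : List (Vec (Fin 3) m)
  S = shapes m a b

-- The extremal matrix avoids F(a,b,1+p′): the columns of a copy are heavy, hence lie in the
-- blocks and have exactly a zeros and b ones; being marked by the rows of the copy they share
-- one shape, whose block has only p′ words.
extremal-avoids : (t m a b p′ : ℕ) → Avoids (toMatrix (extremal t m a b p′)) (F a b (suc p′))
extremal-avoids t m a b p′ contains =
  <-irrefl refl (≤-trans (injection-length (block t m p′ q₀) w w-injective w∈block) (block-short t m p′ q₀))
  where
  open Copy (contains⇒copy {a = a} {b = b} {A = toMatrix (extremal t m a b p′)} contains)
  w : Fin (suc p′) → Vec (Fin (suc (suc t))) m
  w j = List.lookup (extremal t m a b p′) (column j)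
  w-injective : Injective _≡_ _≡_ w
  w-injective eq = column-injective (lookup-injective (extremal-unique t m a b p′) eq)
  marked : ∀ j → Marked zeroRow oneRow (w j)
  marked j = (λ i → toℕ-injective (zero-entries i j)) , (λ i → toℕ-injective (one-entries i j))
  blocked : ∀ j → w j ∈ concatMap (block t m p′) (shapes m a b)
  blocked j with ∈-++⁻ (lightWords t m a b) (∈-lookup (column j))
  ... | inj₂ w∈blocks = w∈blocks
  ... | inj₁ w∈light = ⊥-elim (subst T is-heavy (light-member t m a b w∈light))
    where
    is-heavy : light a b (w j) ≡ false
    is-heavy = enough⇒heavy a b (w j) (count-≥ (_≟ᶠ Fin.zero) (w j) zeroRow zeroRow-injective (proj₁ (marked j)))
                                       (count-≥ (_≟ᶠ one) (w j) oneRow oneRow-injective (proj₂ (marked j)))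
  q₀ : Vec (Fin 3) m
  q₀ = shape (w Fin.zero)
  w∈block : ∀ j → w j ∈ block t m p′ q₀
  w∈block j with find (∈-concatMap⁻ (block t m p′) {xs = shapes m a b} (blocked j))
  ... | q , _ , w∈ = subst (λ q → w j ∈ block t m p′ q) (trans (sym (block-shape t m p′ q w∈)) same-shape) w∈
    where
    same-shape : shape (w j) ≡ shape (w Fin.zero)
    same-shape = marked-same-shape zeroRow oneRow zeroRow-injective oneRow-injective (w j) (w Fin.zero)
                   (marked j) (marked Fin.zero) (blocked-sizes t m a b p′ (blocked j)) (blocked-sizes t m a b p′ (blocked Fin.zero))


sumBelow : ℕ → (ℕ → ℕ) → ℕ
sumBelow zero f = 0
sumBelow (suc n) f = sumBelow n f + f n

sumTo-+ : (n : ℕ) (f : ℕ → ℕ) → sumTo n (λ i → + f i) ≡ + sumBelow n f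
sumTo-+ zero f = refl
sumTo-+ (suc n) f = trans (cong (ℤ._+ + f n) (sumTo-+ n f)) (sym (ℤ.pos-+ (sumBelow n f) (f n)))

sumTo-cong : (n : ℕ) {f g : ℕ → ℤ} → (∀ i → f i ≡ g i) → sumTo n f ≡ sumTo n g
sumTo-cong zero f≗g = refl
sumTo-cong (suc n) f≗g = cong₂ ℤ._+_ (sumTo-cong n f≗g) (f≗g n)

sumBelow-cong : (n : ℕ) {f g : ℕ → ℕ} → (∀ i → f i ≡ g i) → sumBelow n f ≡ sumBelow n g
sumBelow-cong zero f≗g = refl
sumBelow-cong (suc n) f≗g = cong₂ _+_ (sumBelow-cong n f≗g) (f≗g n)

∑-sumBelow : (xs : List A) (n : ℕ) (f : A → ℕ → ℕ) →
  ∑ xs (λ x → sumBelow n (f x)) ≡ sumBelow n (λ i → ∑ xs (λ x → f x i))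
∑-sumBelow xs zero f = ∑-zero xs
∑-sumBelow xs (suc n) f =
  trans (∑-+ xs (λ x → sumBelow n (f x)) (λ x → f x n)) (cong (_+ ∑ xs (λ x → f x n)) (∑-sumBelow xs n f))

sumBelow-*ʳ : (n : ℕ) (f : ℕ → ℕ) (c : ℕ) → sumBelow n f * c ≡ sumBelow n (λ i → f i * c)
sumBelow-*ʳ zero f c = refl
sumBelow-*ʳ (suc n) f c = trans (*-distribʳ-+ c (sumBelow n f) (f n)) (cong (_+ f n * c) (sumBelow-*ʳ n f c))

sumBelow-*ˡ : (n : ℕ) (f : ℕ → ℕ) (c : ℕ) → c * sumBelow n f ≡ sumBelow n (λ i → c * f i)
sumBelow-*ˡ n f c =
  trans (*-comm c (sumBelow n f)) (trans (sumBelow-*ʳ n f c) (sumBelow-cong n (λ i → *-comm (f i) c)))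

𝟙-∧ : (x y : Bool) → 𝟙 (x ∧ y) ≡ 𝟙 x * 𝟙 y
𝟙-∧ true true = refl
𝟙-∧ true false = refl
𝟙-∧ false y = refl

𝟙-∨ : (x y : Bool) → 𝟙 (x ∨ y) + 𝟙 (x ∧ y) ≡ 𝟙 x + 𝟙 y
𝟙-∨ true true = refl
𝟙-∨ true false = refl
𝟙-∨ false true = refl
𝟙-∨ false false = refl

𝟙-<ᵇ : (z a : ℕ) → 𝟙 (z <ᵇ a) ≡ sumBelow a (λ ℓ → 𝟙 (z ≡ᵇ ℓ))
𝟙-<ᵇ z zero = refl
𝟙-<ᵇ z (suc a) = trans (𝟙-<ᵇ-suc z a) (cong (_+ 𝟙 (z ≡ᵇ a)) (𝟙-<ᵇ z a))
  where
  𝟙-<ᵇ-suc : ∀ z a → 𝟙 (z <ᵇ suc a) ≡ 𝟙 (z <ᵇ a) + 𝟙 (z ≡ᵇ a)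
  𝟙-<ᵇ-suc zero zero = refl
  𝟙-<ᵇ-suc zero (suc a) = refl
  𝟙-<ᵇ-suc (suc z) zero = refl
  𝟙-<ᵇ-suc (suc z) (suc a) = 𝟙-<ᵇ-suc z a

fewer-count : (s m : ℕ) (x : Fin (suc s)) (a : ℕ) →
  ∑ (words (suc s) m) (λ v → 𝟙 (occ x v <ᵇ a)) ≡ sumBelow a (binomPow s m)
fewer-count s m x a = begin
  ∑ W (λ v → 𝟙 (occ x v <ᵇ a))                      ≡⟨ ∑-cong W (λ v _ → 𝟙-<ᵇ (occ x v) a) ⟩
  ∑ W (λ v → sumBelow a (λ ℓ → 𝟙 (occ x v ≡ᵇ ℓ)))   ≡⟨ ∑-sumBelow W a (λ v ℓ → 𝟙 (occ x v ≡ᵇ ℓ)) ⟩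
  sumBelow a (letterCount s m x)                     ≡⟨ sumBelow-cong a (letterCount-closed s m x) ⟩
  sumBelow a (binomPow s m)                          ∎
  where
  open ≡-Reasoning
  W : List (Vec (Fin (suc s)) m)
  W = words (suc s) m

fewer-both-count : (t m a b : ℕ) →
  ∑ (words (suc (suc t)) m) (λ v → 𝟙 ((occ Fin.zero v <ᵇ a) ∧ (occ one v <ᵇ b))) ≡
  sumBelow a (λ ℓ → sumBelow b (trinomPow t m ℓ))
fewer-both-count t m a b = begin
  ∑ W (λ v → 𝟙 ((occ Fin.zero v <ᵇ a) ∧ (occ one v <ᵇ b)))
    ≡⟨ ∑-cong W (λ v _ → split (occ Fin.zero v) (occ one v)) ⟩
  ∑ W (λ v → sumBelow a (λ ℓ → sumBelow b (λ k → 𝟙 ((occ Fin.zero v ≡ᵇ ℓ) ∧ (occ one v ≡ᵇ k)))))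
    ≡⟨ ∑-sumBelow W a _ ⟩
  sumBelow a (λ ℓ → ∑ W (λ v → sumBelow b (λ k → 𝟙 ((occ Fin.zero v ≡ᵇ ℓ) ∧ (occ one v ≡ᵇ k)))))
    ≡⟨ sumBelow-cong a (λ ℓ → ∑-sumBelow W b _) ⟩
  sumBelow a (λ ℓ → sumBelow b (zeroOneCount t m ℓ))
    ≡⟨ sumBelow-cong a (λ ℓ → sumBelow-cong b (zeroOneCount-closed t m ℓ)) ⟩
  sumBelow a (λ ℓ → sumBelow b (trinomPow t m ℓ)) ∎
  where
  open ≡-Reasoning
  W : List (Vec (Fin (suc (suc t))) m)
  W = words (suc (suc t)) m
  split : ∀ z o → 𝟙 ((z <ᵇ a) ∧ (o <ᵇ b)) ≡ sumBelow a (λ ℓ → sumBelow b (λ k → 𝟙 ((z ≡ᵇ ℓ) ∧ (o ≡ᵇ k))))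
  split z o = begin
    𝟙 ((z <ᵇ a) ∧ (o <ᵇ b))                                   ≡⟨ 𝟙-∧ (z <ᵇ a) (o <ᵇ b) ⟩
    𝟙 (z <ᵇ a) * 𝟙 (o <ᵇ b)                                   ≡⟨ cong₂ _*_ (𝟙-<ᵇ z a) (𝟙-<ᵇ o b) ⟩
    sumBelow a (λ ℓ → 𝟙 (z ≡ᵇ ℓ)) * sumBelow b (λ k → 𝟙 (o ≡ᵇ k)) ≡⟨ sumBelow-*ʳ a _ _ ⟩
    sumBelow a (λ ℓ → 𝟙 (z ≡ᵇ ℓ) * sumBelow b (λ k → 𝟙 (o ≡ᵇ k)))
      ≡⟨ sumBelow-cong a (λ ℓ → trans (sumBelow-*ˡ b (λ k → 𝟙 (o ≡ᵇ k)) (𝟙 (z ≡ᵇ ℓ)))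
                                       (sumBelow-cong b (λ k → sym (𝟙-∧ (z ≡ᵇ ℓ) (o ≡ᵇ k))))) ⟩
    sumBelow a (λ ℓ → sumBelow b (λ k → 𝟙 ((z ≡ᵇ ℓ) ∧ (o ≡ᵇ k)))) ∎

light-count : (t m a b : ℕ) →
  length (lightWords t m a b) + sumBelow a (λ ℓ → sumBelow b (trinomPow t m ℓ)) ≡
  sumBelow a (binomPow (suc t) m) + sumBelow b (binomPow (suc t) m)
light-count t m a b = begin
  length (lightWords t m a b) + sumBelow a (λ ℓ → sumBelow b (trinomPow t m ℓ))
    ≡⟨ cong₂ _+_ (length-filter (T? ∘ light a b) W) (sym (fewer-both-count t m a b)) ⟩
  ∑ W (λ v → 𝟙 (light a b v)) + ∑ W (λ v → 𝟙 (few-zeros v ∧ few-ones v))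
    ≡⟨ sym (∑-+ W _ _) ⟩
  ∑ W (λ v → 𝟙 (light a b v) + 𝟙 (few-zeros v ∧ few-ones v))
    ≡⟨ ∑-cong W (λ v _ → 𝟙-∨ (few-zeros v) (few-ones v)) ⟩
  ∑ W (λ v → 𝟙 (few-zeros v) + 𝟙 (few-ones v))             ≡⟨ ∑-+ W _ _ ⟩
  ∑ W (λ v → 𝟙 (few-zeros v)) + ∑ W (λ v → 𝟙 (few-ones v))
    ≡⟨ cong₂ _+_ (fewer-count (suc t) m Fin.zero a) (fewer-count (suc t) m one b) ⟩
  sumBelow a (binomPow (suc t) m) + sumBelow b (binomPow (suc t) m) ∎
  where
  open ≡-Reasoning
  W : List (Vec (Fin (suc (suc t))) m)
  W = words (suc (suc t)) m
  few-zeros few-ones : Vec (Fin (suc (suc t))) m → Bool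
  few-zeros v = occ Fin.zero v <ᵇ a
  few-ones v = occ one v <ᵇ b

shapes-count : (m a b : ℕ) → length (shapes m a b) ≡ (m C a) * ((m ∸ a) C b)
shapes-count m a b =
  trans (length-filter (T? ∘ isShape a b) (words 3 m))
   (trans (zeroOneCount-closed 1 m a b)
     (cong ((m C a) *_) (trans (cong (((m ∸ a) C b) *_) (^-zeroˡ (m ∸ a ∸ b))) (*-identityʳ _))))

rhs-value : (t m a b p′ : ℕ) →
  rhs m (suc (suc t)) a b (suc p′) ≡ + (length (lightWords t m a b) + length (shapes m a b) * p′)
rhs-value t m a b p′ = begin
  rhs m (suc (suc t)) a b (suc p′)
    ≡⟨ cong₂ (λ x y → x ℤ.+ y ℤ.- excluded ℤ.+ + (p′ * (m C a) * ((m ∸ a) C b)))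
             (sumTo-+ a (binomPow (suc t) m)) (sumTo-+ b (binomPow (suc t) m)) ⟩
  + S₁ ℤ.+ + S₂ ℤ.- excluded ℤ.+ + (p′ * (m C a) * ((m ∸ a) C b))
    ≡⟨ cong₂ (λ x y → + S₁ ℤ.+ + S₂ ℤ.- x ℤ.+ + y) excluded-value charged-value ⟩
  + S₁ ℤ.+ + S₂ ℤ.- + S₃ ℤ.+ + (length (shapes m a b) * p′)
    ≡⟨ cong (λ x → x ℤ.- + S₃ ℤ.+ + (length (shapes m a b) * p′))
            (trans (sym (ℤ.pos-+ S₁ S₂)) (trans (cong +_ (sym (light-count t m a b))) (ℤ.pos-+ L S₃))) ⟩
  + L ℤ.+ + S₃ ℤ.- + S₃ ℤ.+ + (length (shapes m a b) * p′)
    ≡⟨ cancel (+ L) (+ S₃) (+ (length (shapes m a b) * p′)) ⟩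
  + L ℤ.+ + (length (shapes m a b) * p′)    ≡⟨ sym (ℤ.pos-+ L _) ⟩
  + (L + length (shapes m a b) * p′)        ∎
  where
  open ≡-Reasoning
  L S₁ S₂ S₃ : ℕ
  L = length (lightWords t m a b)
  S₁ = sumBelow a (binomPow (suc t) m)
  S₂ = sumBelow b (binomPow (suc t) m)
  S₃ = sumBelow a (λ ℓ → sumBelow b (trinomPow t m ℓ))
  excluded : ℤ
  excluded = sumTo a (λ ℓ → sumTo b (λ k → + ((m C ℓ) * ((m ∸ ℓ) C k) * t ^ (m ∸ ℓ ∸ k))))
  excluded-value : excluded ≡ + S₃
  excluded-value =
    trans (sumTo-cong a (λ ℓ → trans (sumTo-cong b (λ k → cong +_ (*-assoc (m C ℓ) _ _))) (sumTo-+ b (trinomPow t m ℓ))))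
          (sumTo-+ a (λ ℓ → sumBelow b (trinomPow t m ℓ)))
  charged-value : p′ * (m C a) * ((m ∸ a) C b) ≡ length (shapes m a b) * p′
  charged-value = trans (*-assoc p′ _ _) (trans (*-comm p′ _) (cong (_* p′) (sym (shapes-count m a b))))
  cancel : ∀ (g s y : ℤ) → g ℤ.+ s ℤ.- s ℤ.+ y ≡ g ℤ.+ y
  cancel = ℤ-Solver.solve-∀


proposition5p1 : (r a b p m : ℕ) → 2 ≤ r → 1 ≤ a → 1 ≤ b → 1 ≤ p → a + b ≤ m →
    p ∸ 1 ≤ (r ∸ 2) ^ (m ∸ a ∸ b) →
    ForbIs m r (F a b p) (rhs m r a b p)
proposition5p1 (suc (suc t)) a b (suc p′) m (s≤s (s≤s z≤n)) _ _ (s≤s z≤n) _ p′≤t^[m-a-b] =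
  (length columns , toMatrix columns , toMatrix-simple (extremal-unique t m a b p′) ,
   extremal-avoids t m a b p′ , attains) ,
  bounded
  where
  columns : List (Vec (Fin (suc (suc t))) m)
  columns = extremal t m a b p′
  attains : + length columns ≡ rhs m (suc (suc t)) a b (suc p′)
  attains = trans (cong +_ (extremal-length t m a b p′ p′≤t^[m-a-b])) (sym (rhs-value t m a b p′))
  bounded : (n : ℕ) (A : Matrix m n (suc (suc t))) → Simple A → Avoids A (F a b (suc p′)) →
    + n ℤ.≤ rhs m (suc (suc t)) a b (suc p′)
  bounded n A simple avoids =
    subst (+ n ℤ.≤_) (sym (rhs-value t m a b p′)) (ℤ.+≤+ (upper-bound t m a b p′ A simple avoids))
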